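{- Let $n\ge1$, $\zeta_i\in wAC(P)$ and $\alpha_i\in\{0,1\}$ for $i\in[n]$. Then, as elements of $wAI(P)/\equiv$, $$\Big|\bigotimes_{i\in[n]}[\zeta_i]^{\alpha_i}\Big|\oplus\bigotimes_{i\in[n]}\big(1\oplus|\zeta_i|\big)=\bigotimes_{i\in[n]}\big(1\oplus|\zeta_i|\big).$$
   Context: $(K,\oplus,\otimes,\hat0,\hat1)$ is a commutative, additively idempotent semiring; $P$ is a finite nonempty set of ports with $0,1\notin P$ and weights $k_p\in K$. $wAI(P)$ is the weighted Algebra of Interactions: terms $z::=0\mid1\mid p\mid z\oplus z\mid z\otimes z\mid(z)$, with semantics $\|z\|(\gamma)\in K$ for $\gamma\in\Gamma(P)=2^{2^P}$: $\|0\|(\gamma)=\hat0$; $\|1\|(\gamma)=\hat1$ iff $\emptyset\in\gamma$ (else $\hat0$); $\|p\|(\gamma)=k_p$ if some $a\in\gamma$ contains $p$ (else $\hat0$); $\|z_1\oplus z_2\|(\gamma)=\bigoplus_{a\in\gamma}(\|z_1\|(\{a\})\oplus\|z_2\|(\{a\}))$; $\|z_1\otimes z_2\|(\gamma)=\bigoplus_{a\in\gamma}\bigoplus_{a_1\cup a_2=a}(\|z_1\|(\{a_1\})\otimes\|z_2\|(\{a_2\}))$ (inner sum over pairs of possibly empty subsets of $P$); $\|(z)\|=\|z\|$. On $wAI(P)$, $z_1\equiv z_2$ iff $\|z_1\|=\|z_2\|$ on all of $\Gamma(P)$; $wAI(P)/\equiv$ is a commutative idempotent semiring under $\oplus,\otimes$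 with zero $\overline0$ and one $\overline1$, and $wAI(P)$ terms are identified with their classes. The weighted Algebra of Connectors $wAC(P)$ has syntax: synchrons $\sigma::=[0]\mid[1]\mid[p]\mid[\zeta]$, triggers $\tau::=[0]'\mid[1]'\mid[p]'\mid[\zeta]'$, and $\zeta::=\sigma\mid\tau\mid\zeta\oplus\zeta\mid\zeta\otimes\zeta$, where weighted fusion $\otimes$ is applied to typed connectors; $[\zeta]^{\alpha}$ is $[\zeta]$ if $\alpha=0$ and $[\zeta]'$ if $\alpha=1$. Semantics $|\cdot|:wAC(P)\to wAI(P)$: $|[p]|=|[p]'|=p$ for $p\in P\cup\{0,1\}$; $|[\zeta]|=|[\zeta]'|=|\zeta|$; $|\zeta_1\oplus\zeta_2|=|\zeta_1|\oplus|\zeta_2|$; $|[\zeta_1]\otimes\cdots\otimes[\zeta_n]|=|\zeta_1|\otimes\cdots\otimes|\zeta_n|$; and if at least one $\alpha_i=1$, $|[\zeta_1]^{\alpha_1}\otimes\cdots\otimes[\zeta_n]^{\alpha_n}|=\bigoplus_{i:\alpha_i=1}\big(|\zeta_i|\otimes\bigotimes_{k\ne i,\alpha_k=1}(1\oplus|\zeta_k|)\otimes\bigotimes_{j:\alpha_j=0}(1\oplus|\zeta_j|)\big)$. -}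

module Defs where

open import Level using (Level)
open import Data.Bool using (Bool; true; false; if_then_else_; _∧_)
open import Data.Nat using (ℕ; zero; suc)
open import Data.Fin using (Fin)
open import Data.Fin.Subset using (Subset; ⊥; _∪_)
open import Data.List using (List; []; _∷_; _++_; map; concatMap; foldr; filter)
open import Data.Bool.ListAction using (any)
open import Data.Vec using (Vec; []; _∷_; lookup; tabulate; toList; allFin)
open import Data.Vec.Properties using (≡-dec)
open import Data.Product using (_×_; _,_; proj₁; proj₂)
open import Relation.Nullary.Decidable using (⌊_⌋)
open import Relation.Binary.PropositionalEquality using (_≡_)
open import Algebra.Bundles using (CommutativeSemiring)
import Data.Bool.Properties as BP
import Data.Fin.Properties as FP

-- Ports: P = Fin m (a finite set; nonemptiness is imposed in the theorem).
-- A subset a ⊆ P is a 'Subset m'; an element γ ∈ Γ(P) = 2^(2^P) is given by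
-- its characteristic function 'Subset m → Bool'.

Interaction : ℕ → Set
Interaction m = Subset m

Γ : ℕ → Set
Γ m = Subset m → Bool

allSubsets : (m : ℕ) → List (Subset m)
allSubsets zero = [] ∷ []
allSubsets (suc m) = map (true ∷_) (allSubsets m) ++ map (false ∷_) (allSubsets m)

_≟ˢ_ : {m : ℕ} → (a b : Subset m) → Bool
a ≟ˢ b = ⌊ ≡-dec BP._≟_ a b ⌋

singleton : {m : ℕ} → Subset m → Γ m
singleton a b = b ≟ˢ a

members : {m : ℕ} → Γ m → List (Subset m)
members {m} γ = filter (λ a → γ a BP.≟ true) (allSubsets m)

splits : {m : ℕ} → Subset m → List (Subset m × Subset m)
splits {m} a = filter (λ q → ≡-dec BP._≟_ (proj₁ q ∪ proj₂ q) a)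
                 (concatMap (λ a₁ → map (a₁ ,_) (allSubsets m)) (allSubsets m))

infixl 6 _⊕ᵗ_
infixl 7 _⊗ᵗ_

data wAI (m : ℕ) : Set where
  𝟘 : wAI m
  𝟙 : wAI m
  port : Fin m → wAI m
  _⊕ᵗ_ : wAI m → wAI m → wAI m
  _⊗ᵗ_ : wAI m → wAI m → wAI m
-- parentheses (z) are just grouping, so they are not a separate constructor
-- (the paper sets ‖(z)‖ = ‖z‖).

⨁ᵗ : {m : ℕ} → List (wAI m) → wAI m
⨁ᵗ [] = 𝟘
⨁ᵗ (z ∷ []) = z
⨁ᵗ (z ∷ zs@(_ ∷ _)) = z ⊕ᵗ ⨁ᵗ zs

⨂ᵗ : {m : ℕ} → List (wAI m) → wAI m
⨂ᵗ [] = 𝟙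
⨂ᵗ (z ∷ []) = z
⨂ᵗ (z ∷ zs@(_ ∷ _)) = z ⊗ᵗ ⨂ᵗ zs

module Sem {c ℓ : Level} (K : CommutativeSemiring c ℓ) {m : ℕ}
           (k : Fin m → CommutativeSemiring.Carrier K) where
  open CommutativeSemiring K

  ⨁ : List Carrier → Carrier
  ⨁ = foldr _+_ 0#

  ⟦_⟧ : wAI m → Γ m → Carrier
  ⟦ 𝟘 ⟧ γ = 0#
  ⟦ 𝟙 ⟧ γ = if γ ⊥ then 1# else 0#
  ⟦ port p ⟧ γ = if any (λ a → γ a ∧ lookup a p) (allSubsets m) then k p else 0#
  ⟦ z₁ ⊕ᵗ z₂ ⟧ γ = ⨁ (map (λ a → ⟦ z₁ ⟧ (singleton a) + ⟦ z₂ ⟧ (singleton a)) (members γ))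
  ⟦ z₁ ⊗ᵗ z₂ ⟧ γ = ⨁ (map (λ a → ⨁ (map (λ q → ⟦ z₁ ⟧ (singleton (proj₁ q)) * ⟦ z₂ ⟧ (singleton (proj₂ q)))
                                        (splits a)))
                           (members γ))

  -- z₁ ≡ z₂ iff ‖z₁‖ = ‖z₂‖ on all of Γ(P)  (equality in wAI(P)/≡)
  infix 4 _≡ᵂ_
  _≡ᵂ_ : wAI m → wAI m → Set ℓ
  z₁ ≡ᵂ z₂ = (γ : Γ m) → ⟦ z₁ ⟧ γ ≈ ⟦ z₂ ⟧ γ

-- Atoms: 0, 1, p.  A typed connector is [x]^α with α : Bool
-- (false = synchron [x], true = trigger [x]'), x an atom or a connector ζ.
-- Weighted fusion ⊗ is applied to typed connectors; a fusion
-- [ζ₁]^α₁ ⊗ ⋯ ⊗ [ζₙ]^αₙ (n ≥ 1) is represented by the constructor 'fuse'.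

data Atom (m : ℕ) : Set where
  a0 a1 : Atom m
  ap : Fin m → Atom m

atomSem : {m : ℕ} → Atom m → wAI m
atomSem a0 = 𝟘
atomSem a1 = 𝟙
atomSem (ap p) = port p

mutual
  data Typed (m : ℕ) : Set where
    atomᵗ : Atom m → Bool → Typed m
    brack : wAC m → Bool → Typed m

  data wAC (m : ℕ) : Set where
    typed : Typed m → wAC m
    _⊕ᶜ_ : wAC m → wAC m → wAC m
    fuse : {n : ℕ} → Vec (Typed m) (suc n) → wAC m

[_]^_ : {m : ℕ} → wAC m → Bool → Typed m
[ ζ ]^ α = brack ζ α

-- Semantics of a fusion, given for each typed component (αᵢ , |ζᵢ|).
fusionSem : {m n : ℕ} → Vec (Bool × wAI m) n → wAI m
fusionSem {m} {n} xs =
  if any (λ i → α i) idx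
  then ⨁ᵗ (map (λ i → z i ⊗ᵗ (⨂ᵗ (map (λ k → 𝟙 ⊕ᵗ z k)
                                     (filter (λ k → ⌊ Relation.Nullary.Decidable.¬? (k FP.≟ i) ⌋ ∧ α k BP.≟ true) idx))
                            ⊗ᵗ ⨂ᵗ (map (λ j → 𝟙 ⊕ᵗ z j) (filter (λ j → α j BP.≟ false) idx))))
               (filter (λ i → α i BP.≟ true) idx))
  else ⨂ᵗ (map z idx)
  where
    idx : List (Fin n)
    idx = toList (allFin n)
    α : Fin n → Bool
    α i = proj₁ (lookup xs i)
    z : Fin n → wAI m
    z i = proj₂ (lookup xs i)

mutual
  ∣_∣ : {m : ℕ} → wAC m → wAI m
  ∣ typed t ∣ = ∣ t ∣ᵗ
  ∣ ζ₁ ⊕ᶜ ζ₂ ∣ = ∣ ζ₁ ∣ ⊕ᵗ ∣ ζ₂ ∣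
  ∣ fuse ts ∣ = fusionSem (semVec ts)

  ∣_∣ᵗ : {m : ℕ} → Typed m → wAI m
  ∣ atomᵗ x α ∣ᵗ = atomSem x
  ∣ brack ζ α ∣ᵗ = ∣ ζ ∣

  typeOf : {m : ℕ} → Typed m → Bool
  typeOf (atomᵗ x α) = α
  typeOf (brack ζ α) = α

  semVec : {m n : ℕ} → Vec (Typed m) n → Vec (Bool × wAI m) n
  semVec [] = []
  semVec (t ∷ ts) = (typeOf t , ∣ t ∣ᵗ) ∷ semVec ts

{-# OPTIONS --safe #-}
-- Compare wAI terms through their values on singletons: x ⊑ y when ‖x‖({a}) ≤ ‖y‖({a}) for
-- every interaction a, where x ≤ y ⟺ x ⊕ y = y is the natural order of the idempotent
-- semiring K. On singletons ⊗ is monotone, associative, commutative and has unit 1.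
-- Pad the fusion summand of a trigger i,
--   |ζᵢ| ⊗ ⨂_{k ≠ i trigger} (1 ⊕ |ζₖ|) ⊗ ⨂_{j synchron} (1 ⊕ |ζⱼ|),
-- to a product over all indices by inserting the factor 1 ⊑ 1 ⊕ |ζⱼ| wherever j is missing.
-- Since i, the other triggers and the synchrons are disjoint, every index then carries at most
-- one factor 1 ⊕ |ζⱼ|, so the summand is ⊑ G = ⨂ⱼ (1 ⊕ |ζⱼ|); so is ⨂ⱼ |ζⱼ| when there is no
-- trigger. Finally a ⊕- or ⊗-term is additive, ‖z‖(γ) = ⨁_{a ∈ γ} ‖z‖({a}), and for an
-- additive G the inequality L ⊑ G gives L ⊕ G ≡ G by idempotence of ⊕.
module Submission where

open import Defs
open import Level using (Level; 0ℓ)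
open import Data.Bool using (Bool; true; false; if_then_else_; _∧_)
open import Data.Bool.ListAction using (any)
open import Data.Sum using (_⊎_; inj₁; inj₂)
open import Data.Nat using (ℕ; suc)
open import Data.Fin using (Fin)
open import Data.Fin.Properties using () renaming (_≟_ to _≟ᶠ_)
open import Data.Fin.Subset using (Subset; ⊥; _∪_)
open import Data.List using (List; []; _∷_; map; concatMap; foldr; filter)
open import Data.List.Membership.Propositional using (_∈_)
open import Data.List.Membership.Propositional.Properties
  using (∈-map⁺; ∈-++⁺ˡ; ∈-++⁺ʳ; ∈-filter⁺; ∈-filter⁻; ∈-concatMap⁺)
open import Data.List.Relation.Unary.Any using (here; there)
import Data.List.Relation.Unary.Any as Any
open import Data.Product using (_×_; _,_; proj₁; proj₂; swap; zip)
open import Data.Empty using (⊥-elim)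
open import Relation.Nullary using (¬_; Dec; yes; no)
open import Relation.Unary using (Decidable)
open import Relation.Nullary.Decidable using (⌊_⌋; ¬?; _⊎-dec_)
open import Relation.Binary.PropositionalEquality using (_≡_; refl)
import Relation.Binary.PropositionalEquality as ≡
open import Algebra.Bundles using (CommutativeSemiring)
open import Algebra.Definitions using (Idempotent)
open import Algebra.Lattice.Bundles using (Semilattice)
open import Algebra.Lattice.Properties.Semilattice using (∧-orderTheoreticJoinSemilattice)
open import Relation.Binary.Lattice.Bundles using (JoinSemilattice)
import Relation.Binary.Lattice.Properties.JoinSemilattice as JoinSemilatticeProperties
open import Data.Vec using (Vec; []; _∷_; lookup; toList; allFin; zipWith)
import Data.Vec as V
import Data.Vec.Properties as VP
open import Function using (_∘_)
open import Data.Vec.Membership.Propositional.Properties using (∈-toList⁺; ∈-allFin⁺)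
open import Data.Vec.Properties using (≡-dec)
import Data.Bool.Properties as BP
import Data.Fin.Subset.Properties as Subset
open import Relation.Binary.Bundles using (Preorder)
import Relation.Binary.Reasoning.Preorder as PreorderReasoning

∈-allSubsets : ∀ {m} (a : Subset m) → a ∈ allSubsets m
∈-allSubsets [] = here refl
∈-allSubsets {suc m} (true ∷ a) = ∈-++⁺ˡ (∈-map⁺ (true ∷_) (∈-allSubsets a))
∈-allSubsets {suc m} (false ∷ a) =
  ∈-++⁺ʳ (map (true ∷_) (allSubsets m)) (∈-map⁺ (false ∷_) (∈-allSubsets a))

∈-members-singleton⁺ : ∀ {m} (a : Subset m) → a ∈ members (singleton a)
∈-members-singleton⁺ a =
  ∈-filter⁺ (λ b → singleton a b BP.≟ true) (∈-allSubsets a) (singleton-self a)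
  where
  singleton-self : ∀ {m} (a : Subset m) → singleton a a ≡ true
  singleton-self a with ≡-dec BP._≟_ a a
  ... | yes _ = refl
  ... | no a≢a = ⊥-elim (a≢a refl)

∈-members-singleton⁻ : ∀ {m} {a b : Subset m} → b ∈ members (singleton a) → b ≡ a
∈-members-singleton⁻ {m} {a} {b} b∈ =
  singleton-sound (proj₂ (∈-filter⁻ (λ b → singleton a b BP.≟ true) {xs = allSubsets m} b∈))
  where
  singleton-sound : singleton a b ≡ true → b ≡ a
  singleton-sound b∈a with ≡-dec BP._≟_ b a
  ... | yes b≡a = b≡a

∈-splits⁺ : ∀ {m} {a b₁ b₂ : Subset m} → b₁ ∪ b₂ ≡ a → (b₁ , b₂) ∈ splits a
∈-splits⁺ {m} {a} {b₁} {b₂} b₁∪b₂≡a =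
  ∈-filter⁺ (λ q → ≡-dec BP._≟_ (proj₁ q ∪ proj₂ q) a)
    (∈-concatMap⁺ (λ a₁ → map (a₁ ,_) (allSubsets m))
      (Any.map (λ { refl → ∈-map⁺ (b₁ ,_) (∈-allSubsets b₂) }) (∈-allSubsets b₁)))
    b₁∪b₂≡a

∈-splits⁻ : ∀ {m} {a : Subset m} {q} → q ∈ splits a → proj₁ q ∪ proj₂ q ≡ a
∈-splits⁻ {m} {a} q∈ =
  proj₂ (∈-filter⁻ (λ q → ≡-dec BP._≟_ (proj₁ q ∪ proj₂ q) a)
           {xs = concatMap (λ a₁ → map (a₁ ,_) (allSubsets m)) (allSubsets m)} q∈)

module NaturalOrder {c ℓ : Level} (K : CommutativeSemiring c ℓ)
  (+-idem : Idempotent (CommutativeSemiring._≈_ K) (CommutativeSemiring._+_ K)) where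

  open CommutativeSemiring K renaming (refl to ≈-refl; sym to ≈-sym; trans to ≈-trans)

  +-semilattice : Semilattice c ℓ
  +-semilattice = record
    { _∙_           = _+_
    ; isSemilattice = record
      { isBand = record { isSemigroup = +-isSemigroup ; idem = +-idem }
      ; comm   = +-comm
      }
    }

  -- Its order x ≤ y unfolds to y ≈ y + x.
  +-joinSemilattice : JoinSemilattice c ℓ ℓ
  +-joinSemilattice = ∧-orderTheoreticJoinSemilattice +-semilattice

  open JoinSemilattice +-joinSemilattice public
    using (_≤_; x≤x∨y; y≤x∨y; ∨-least; ≤-respˡ-≈; ≤-respʳ-≈)
    renaming (refl to ≤-refl; reflexive to ≤-reflexive; trans to ≤-trans; antisym to ≤-antisym)
  open JoinSemilatticeProperties +-joinSemilattice public
    using (x≤y⇒x∨y≈y)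

  0#-minimum : ∀ x → 0# ≤ x
  0#-minimum x = ≈-sym (+-identityʳ x)

  *-monoʳ-≤ : ∀ z {x y} → x ≤ y → x * z ≤ y * z
  *-monoʳ-≤ z {x} {y} y≈y+x = ≈-trans (*-congʳ y≈y+x) (distribʳ z y x)

  *-monoˡ-≤ : ∀ z {x y} → x ≤ y → z * x ≤ z * y
  *-monoˡ-≤ z {x} {y} y≈y+x = ≈-trans (*-congˡ y≈y+x) (distribˡ z y x)

  *-mono-≤ : ∀ {x x′ y y′} → x ≤ x′ → y ≤ y′ → x * y ≤ x′ * y′
  *-mono-≤ {x′ = x′} {y = y} x≤x′ y≤y′ = ≤-trans (*-monoʳ-≤ y x≤x′) (*-monoˡ-≤ x′ y≤y′)

  ∑ : List Carrier → Carrier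
  ∑ = foldr _+_ 0#

  module _ {A : Set} (g : A → Carrier) where

    ∑-least : ∀ (l : List A) {z} → (∀ {e} → e ∈ l → g e ≤ z) → ∑ (map g l) ≤ z
    ∑-least []      _     = 0#-minimum _
    ∑-least (e ∷ l) bound =
      ∨-least (bound (here refl)) (∑-least l (λ e∈l → bound (there e∈l)))

    ≤-∑ : ∀ {l : List A} {e} → e ∈ l → g e ≤ ∑ (map g l)
    ≤-∑ (here refl) = x≤x∨y _ _
    ≤-∑ (there e∈l) = ≤-trans (≤-∑ e∈l) (y≤x∨y _ _)

    ∑-*-distribʳ : ∀ (l : List A) z → ∑ (map g l) * z ≈ ∑ (map (λ e → g e * z) l)
    ∑-*-distribʳ []      z = zeroˡ z
    ∑-*-distribʳ (e ∷ l) z = ≈-trans (distribʳ z (g e) _) (+-congˡ (∑-*-distribʳ l z))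

  ∑-cong : ∀ {A : Set} {g g′ : A → Carrier} (l : List A) →
    (∀ {e} → e ∈ l → g e ≈ g′ e) → ∑ (map g l) ≈ ∑ (map g′ l)
  ∑-cong []      _    = ≈-refl
  ∑-cong (e ∷ l) g≈g′ = +-cong (g≈g′ (here refl)) (∑-cong l (λ e∈l → g≈g′ (there e∈l)))

module Singletonwise {c ℓ : Level} (K : CommutativeSemiring c ℓ)
  (+-idem : Idempotent (CommutativeSemiring._≈_ K) (CommutativeSemiring._+_ K))
  {m : ℕ} (k : Fin m → CommutativeSemiring.Carrier K) where

  open CommutativeSemiring K renaming (refl to ≈-refl; sym to ≈-sym; trans to ≈-trans)
  open NaturalOrder K +-idem hiding (∑)
  open Sem K k

  ⟦_⟧[_] : wAI m → Subset m → Carrier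
  ⟦ z ⟧[ a ] = ⟦ z ⟧ (singleton a)

  ⨁-members-singleton : ∀ (g : Subset m → Carrier) a → ⨁ (map g (members (singleton a))) ≈ g a
  ⨁-members-singleton g a = ≤-antisym
    (∑-least g _ (λ b∈ → ≤-reflexive (reflexive (≡.cong g (∈-members-singleton⁻ b∈)))))
    (≤-∑ g (∈-members-singleton⁺ a))

  Additive : wAI m → Set ℓ
  Additive z = ∀ γ → ⟦ z ⟧ γ ≈ ⨁ (map ⟦ z ⟧[_] (members γ))

  module _ (z : wAI m) (g : Subset m → Carrier)
           (⟦z⟧≡ : ∀ γ → ⟦ z ⟧ γ ≡ ⨁ (map g (members γ))) where

    sum-over-members-at : ∀ a → ⟦ z ⟧[ a ] ≈ g a
    sum-over-members-at a = ≈-trans (reflexive (⟦z⟧≡ (singleton a))) (⨁-members-singleton g a)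

    sum-over-members-additive : Additive z
    sum-over-members-additive γ =
      ≈-trans (reflexive (⟦z⟧≡ γ)) (∑-cong (members γ) (λ _ → ≈-sym (sum-over-members-at _)))

  ⊕ᵗ-at : ∀ x y a → ⟦ x ⊕ᵗ y ⟧[ a ] ≈ ⟦ x ⟧[ a ] + ⟦ y ⟧[ a ]
  ⊕ᵗ-at x y = sum-over-members-at (x ⊕ᵗ y) _ (λ _ → refl)

  ⊗ᵗ-at : ∀ x y a →
    ⟦ x ⊗ᵗ y ⟧[ a ] ≈ ⨁ (map (λ q → ⟦ x ⟧[ proj₁ q ] * ⟦ y ⟧[ proj₂ q ]) (splits a))
  ⊗ᵗ-at x y = sum-over-members-at (x ⊗ᵗ y) _ (λ _ → refl)

  ⊕ᵗ-additive : ∀ x y → Additive (x ⊕ᵗ y)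
  ⊕ᵗ-additive x y = sum-over-members-additive (x ⊕ᵗ y) _ (λ _ → refl)

  ⊗ᵗ-additive : ∀ x y → Additive (x ⊗ᵗ y)
  ⊗ᵗ-additive x y = sum-over-members-additive (x ⊗ᵗ y) _ (λ _ → refl)

  𝟙-at-∅ : ⟦ 𝟙 ⟧[ ⊥ ] ≈ 1#
  𝟙-at-∅ with ≡-dec BP._≟_ (⊥ {m}) ⊥
  ... | yes _   = ≈-refl
  ... | no ⊥≢⊥ = ⊥-elim (⊥≢⊥ refl)

  ⊗ᵗ-least-at : ∀ x y a {z} → (∀ b₁ b₂ → b₁ ∪ b₂ ≡ a → ⟦ x ⟧[ b₁ ] * ⟦ y ⟧[ b₂ ] ≤ z) →
    ⟦ x ⊗ᵗ y ⟧[ a ] ≤ z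
  ⊗ᵗ-least-at x y a bound =
    ≤-respˡ-≈ (≈-sym (⊗ᵗ-at x y a)) (∑-least _ (splits a) (λ q∈ → bound _ _ (∈-splits⁻ q∈)))

  ≤-⊗ᵗ-at : ∀ x y {a b₁ b₂} → b₁ ∪ b₂ ≡ a → ⟦ x ⟧[ b₁ ] * ⟦ y ⟧[ b₂ ] ≤ ⟦ x ⊗ᵗ y ⟧[ a ]
  ≤-⊗ᵗ-at x y {a} b₁∪b₂≡a =
    ≤-respʳ-≈ (≈-sym (⊗ᵗ-at x y a))
      (≤-∑ (λ q → ⟦ x ⟧[ proj₁ q ] * ⟦ y ⟧[ proj₂ q ]) (∈-splits⁺ b₁∪b₂≡a))

  infix 4 _⊑_ _≋_

  record _⊑_ (x y : wAI m) : Set ℓ where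
    constructor singletonwise
    field ⊑-at : ∀ a → ⟦ x ⟧[ a ] ≤ ⟦ y ⟧[ a ]
  open _⊑_ public

  _≋_ : wAI m → wAI m → Set ℓ
  x ≋ y = x ⊑ y × y ⊑ x

  ⊑-refl : ∀ {x} → x ⊑ x
  ⊑-refl = singletonwise (λ _ → ≤-refl)

  ⊑-trans : ∀ {x y z} → x ⊑ y → y ⊑ z → x ⊑ z
  ⊑-trans x⊑y y⊑z = singletonwise (λ a → ≤-trans (⊑-at x⊑y a) (⊑-at y⊑z a))

  ⊑-preorder : Preorder 0ℓ ℓ ℓ
  ⊑-preorder = record
    { _≈_        = _≋_
    ; _≲_        = _⊑_
    ; isPreorder = record
      { isEquivalence = record
        { refl  = ⊑-refl , ⊑-refl
        ; sym   = swap
        ; trans = zip ⊑-trans (λ y⊑x z⊑y → ⊑-trans z⊑y y⊑x)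
        }
      ; reflexive = proj₁
      ; trans     = ⊑-trans
      }
    }

  open Preorder ⊑-preorder using (module Eq)
  open PreorderReasoning ⊑-preorder

  x⊑x⊕ᵗy : ∀ x y → x ⊑ x ⊕ᵗ y
  x⊑x⊕ᵗy x y = singletonwise (λ a → ≤-respʳ-≈ (≈-sym (⊕ᵗ-at x y a)) (x≤x∨y _ _))

  y⊑x⊕ᵗy : ∀ x y → y ⊑ x ⊕ᵗ y
  y⊑x⊕ᵗy x y = singletonwise (λ a → ≤-respʳ-≈ (≈-sym (⊕ᵗ-at x y a)) (y≤x∨y _ _))

  ⊕ᵗ-least : ∀ {x y z} → x ⊑ z → y ⊑ z → x ⊕ᵗ y ⊑ z
  ⊕ᵗ-least {x} {y} x⊑z y⊑z =
    singletonwise (λ a → ≤-respˡ-≈ (≈-sym (⊕ᵗ-at x y a)) (∨-least (⊑-at x⊑z a) (⊑-at y⊑z a)))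

  𝟘-minimum : ∀ x → 𝟘 ⊑ x
  𝟘-minimum x = singletonwise (λ a → 0#-minimum _)

  ⊗ᵗ-mono : ∀ {x x′ y y′} → x ⊑ x′ → y ⊑ y′ → x ⊗ᵗ y ⊑ x′ ⊗ᵗ y′
  ⊗ᵗ-mono {x} {x′} {y} {y′} x⊑x′ y⊑y′ = singletonwise λ a →
    ⊗ᵗ-least-at x y a (λ b₁ b₂ b₁∪b₂≡a →
      ≤-trans (*-mono-≤ (⊑-at x⊑x′ b₁) (⊑-at y⊑y′ b₂)) (≤-⊗ᵗ-at x′ y′ b₁∪b₂≡a))

  ⊗ᵗ-monoˡ : ∀ z {x y} → x ⊑ y → z ⊗ᵗ x ⊑ z ⊗ᵗ y
  ⊗ᵗ-monoˡ z = ⊗ᵗ-mono (⊑-refl {z})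

  ⊗ᵗ-cong : ∀ {x x′ y y′} → x ≋ x′ → y ≋ y′ → x ⊗ᵗ y ≋ x′ ⊗ᵗ y′
  ⊗ᵗ-cong x≋x′ y≋y′ = ⊗ᵗ-mono (proj₁ x≋x′) (proj₁ y≋y′) , ⊗ᵗ-mono (proj₂ x≋x′) (proj₂ y≋y′)

  ⊗ᵗ-congˡ : ∀ z {x y} → x ≋ y → z ⊗ᵗ x ≋ z ⊗ᵗ y
  ⊗ᵗ-congˡ z = ⊗ᵗ-cong (Eq.refl {z})

  ⊗ᵗ-congʳ : ∀ z {x y} → x ≋ y → x ⊗ᵗ z ≋ y ⊗ᵗ z
  ⊗ᵗ-congʳ z x≋y = ⊗ᵗ-cong x≋y (Eq.refl {z})

  ⊗ᵗ-comm : ∀ x y → x ⊗ᵗ y ≋ y ⊗ᵗ x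
  ⊗ᵗ-comm x y = swap-⊑ x y , swap-⊑ y x
    where
    swap-⊑ : ∀ x y → x ⊗ᵗ y ⊑ y ⊗ᵗ x
    swap-⊑ x y = singletonwise λ a → ⊗ᵗ-least-at x y a (λ b₁ b₂ b₁∪b₂≡a →
      ≤-respˡ-≈ (*-comm _ _) (≤-⊗ᵗ-at y x (≡.trans (Subset.∪-comm b₂ b₁) b₁∪b₂≡a)))

  ⊗ᵗ-assoc : ∀ x y z → (x ⊗ᵗ y) ⊗ᵗ z ≋ x ⊗ᵗ (y ⊗ᵗ z)
  ⊗ᵗ-assoc x y z = assoc-⊑ x y z , (begin
    x ⊗ᵗ (y ⊗ᵗ z) ≈⟨ ⊗ᵗ-comm x (y ⊗ᵗ z) ⟩
    (y ⊗ᵗ z) ⊗ᵗ x ∼⟨ assoc-⊑ y z x ⟩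
    y ⊗ᵗ (z ⊗ᵗ x) ≈⟨ ⊗ᵗ-comm y (z ⊗ᵗ x) ⟩
    (z ⊗ᵗ x) ⊗ᵗ y ∼⟨ assoc-⊑ z x y ⟩
    z ⊗ᵗ (x ⊗ᵗ y) ≈⟨ ⊗ᵗ-comm z (x ⊗ᵗ y) ⟩
    (x ⊗ᵗ y) ⊗ᵗ z ∎)
    where
    assoc-⊑ : ∀ x y z → (x ⊗ᵗ y) ⊗ᵗ z ⊑ x ⊗ᵗ (y ⊗ᵗ z)
    assoc-⊑ x y z = singletonwise λ a → ⊗ᵗ-least-at (x ⊗ᵗ y) z a (λ b₁₂ b₃ b₁₂∪b₃≡a →
      ≤-respˡ-≈ (≈-sym (≈-trans (*-congʳ (⊗ᵗ-at x y b₁₂)) (∑-*-distribʳ _ (splits b₁₂) _)))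
        (∑-least _ (splits b₁₂) λ {(b₁ , b₂)} q∈ →
          ≤-respˡ-≈ (≈-sym (*-assoc _ _ _))
            (≤-trans (*-monoˡ-≤ _ (≤-⊗ᵗ-at y z {b₂ ∪ b₃} refl))
              (≤-⊗ᵗ-at x (y ⊗ᵗ z) (≡.trans (≡.sym (Subset.∪-assoc b₁ b₂ b₃))
                (≡.trans (≡.cong (_∪ b₃) (∈-splits⁻ q∈)) b₁₂∪b₃≡a))))))

  ⊗ᵗ-identityˡ : ∀ x → 𝟙 ⊗ᵗ x ≋ x
  ⊗ᵗ-identityˡ x =
    singletonwise (λ a → ⊗ᵗ-least-at 𝟙 x a (unit-split a)) ,
    singletonwise (λ a →
      ≤-respˡ-≈ (≈-trans (*-congʳ 𝟙-at-∅) (*-identityˡ _)) (≤-⊗ᵗ-at 𝟙 x (Subset.∪-identityˡ a)))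
    where
    unit-split : ∀ a b₁ b₂ → b₁ ∪ b₂ ≡ a → ⟦ 𝟙 ⟧[ b₁ ] * ⟦ x ⟧[ b₂ ] ≤ ⟦ x ⟧[ a ]
    unit-split a b₁ b₂ b₁∪b₂≡a with ≡-dec BP._≟_ ⊥ b₁
    ... | yes refl = ≤-reflexive (≈-trans (*-identityˡ _) (reflexive (≡.cong ⟦ x ⟧[_]
                       (≡.trans (≡.sym (Subset.∪-identityˡ b₂)) b₁∪b₂≡a))))
    ... | no _     = ≤-respˡ-≈ (≈-sym (zeroˡ _)) (0#-minimum _)

  ⊗ᵗ-identityʳ : ∀ x → x ⊗ᵗ 𝟙 ≋ x
  ⊗ᵗ-identityʳ x = begin-equality
    x ⊗ᵗ 𝟙 ≈⟨ ⊗ᵗ-comm x 𝟙 ⟩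
    𝟙 ⊗ᵗ x ≈⟨ ⊗ᵗ-identityˡ x ⟩
    x      ∎

  ⊗ᵗ-interchange : ∀ w x y z → (w ⊗ᵗ x) ⊗ᵗ (y ⊗ᵗ z) ≋ (w ⊗ᵗ y) ⊗ᵗ (x ⊗ᵗ z)
  ⊗ᵗ-interchange w x y z = begin-equality
    (w ⊗ᵗ x) ⊗ᵗ (y ⊗ᵗ z) ≈⟨ ⊗ᵗ-assoc w x (y ⊗ᵗ z) ⟩
    w ⊗ᵗ (x ⊗ᵗ (y ⊗ᵗ z)) ≈⟨ ⊗ᵗ-congˡ w (⊗ᵗ-assoc x y z) ⟨
    w ⊗ᵗ ((x ⊗ᵗ y) ⊗ᵗ z) ≈⟨ ⊗ᵗ-congˡ w (⊗ᵗ-congʳ z (⊗ᵗ-comm x y)) ⟩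
    w ⊗ᵗ ((y ⊗ᵗ x) ⊗ᵗ z) ≈⟨ ⊗ᵗ-congˡ w (⊗ᵗ-assoc y x z) ⟩
    w ⊗ᵗ (y ⊗ᵗ (x ⊗ᵗ z)) ≈⟨ ⊗ᵗ-assoc w y (x ⊗ᵗ z) ⟨
    (w ⊗ᵗ y) ⊗ᵗ (x ⊗ᵗ z) ∎

  ⨂ᵗ-cons : ∀ x xs → ⨂ᵗ (x ∷ xs) ≋ x ⊗ᵗ ⨂ᵗ xs
  ⨂ᵗ-cons x []      = Eq.sym (⊗ᵗ-identityʳ x)
  ⨂ᵗ-cons x (_ ∷ _) = Eq.refl

  ⨂ᵗ-mono : ∀ {A : Set} {u v : A → wAI m} l → (∀ j → u j ⊑ v j) → ⨂ᵗ (map u l) ⊑ ⨂ᵗ (map v l)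
  ⨂ᵗ-mono []               _   = ⊑-refl
  ⨂ᵗ-mono (j ∷ [])         u⊑v = u⊑v j
  ⨂ᵗ-mono (j ∷ l@(_ ∷ _)) u⊑v = ⊗ᵗ-mono (u⊑v j) (⨂ᵗ-mono l u⊑v)

  ⨂ᵗ-⊗ᵗ-interchange : ∀ {A : Set} (u v : A → wAI m) l →
    ⨂ᵗ (map u l) ⊗ᵗ ⨂ᵗ (map v l) ⊑ ⨂ᵗ (map (λ j → u j ⊗ᵗ v j) l)
  ⨂ᵗ-⊗ᵗ-interchange u v [] = proj₁ (⊗ᵗ-identityˡ 𝟙)
  ⨂ᵗ-⊗ᵗ-interchange u v (j ∷ l) = begin
    ⨂ᵗ (u j ∷ map u l) ⊗ᵗ ⨂ᵗ (v j ∷ map v l)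
      ≈⟨ ⊗ᵗ-cong (⨂ᵗ-cons (u j) (map u l)) (⨂ᵗ-cons (v j) (map v l)) ⟩
    (u j ⊗ᵗ ⨂ᵗ (map u l)) ⊗ᵗ (v j ⊗ᵗ ⨂ᵗ (map v l))
      ≈⟨ ⊗ᵗ-interchange (u j) (⨂ᵗ (map u l)) (v j) (⨂ᵗ (map v l)) ⟩
    (u j ⊗ᵗ v j) ⊗ᵗ (⨂ᵗ (map u l) ⊗ᵗ ⨂ᵗ (map v l))
      ∼⟨ ⊗ᵗ-monoˡ (u j ⊗ᵗ v j) (⨂ᵗ-⊗ᵗ-interchange u v l) ⟩
    (u j ⊗ᵗ v j) ⊗ᵗ ⨂ᵗ (map uv l)
      ≈⟨ ⨂ᵗ-cons (u j ⊗ᵗ v j) (map uv l) ⟨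
    ⨂ᵗ (map uv (j ∷ l)) ∎
    where
    uv = λ j → u j ⊗ᵗ v j

  module _ {A : Set} {u : A → wAI m} (𝟙⊑u : ∀ j → 𝟙 ⊑ u j) where

    𝟙⊑⨂ᵗ : ∀ l → 𝟙 ⊑ ⨂ᵗ (map u l)
    𝟙⊑⨂ᵗ []      = ⊑-refl
    𝟙⊑⨂ᵗ (j ∷ l) = begin
      𝟙                      ≈⟨ ⊗ᵗ-identityˡ 𝟙 ⟨
      𝟙 ⊗ᵗ 𝟙                 ∼⟨ ⊗ᵗ-mono (𝟙⊑u j) (𝟙⊑⨂ᵗ l) ⟩
      u j ⊗ᵗ ⨂ᵗ (map u l)   ≈⟨ ⨂ᵗ-cons (u j) (map u l) ⟨
      ⨂ᵗ (map u (j ∷ l))    ∎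

    factor⊑⨂ᵗ : ∀ {l i} → i ∈ l → u i ⊑ ⨂ᵗ (map u l)
    factor⊑⨂ᵗ {i ∷ l} (here refl) = begin
      u i                   ≈⟨ ⊗ᵗ-identityʳ (u i) ⟨
      u i ⊗ᵗ 𝟙              ∼⟨ ⊗ᵗ-monoˡ (u i) (𝟙⊑⨂ᵗ l) ⟩
      u i ⊗ᵗ ⨂ᵗ (map u l)  ≈⟨ ⨂ᵗ-cons (u i) (map u l) ⟨
      ⨂ᵗ (map u (i ∷ l))   ∎
    factor⊑⨂ᵗ {j ∷ l} {i} (there i∈l) = begin
      u i                   ∼⟨ factor⊑⨂ᵗ i∈l ⟩
      ⨂ᵗ (map u l)         ≈⟨ ⊗ᵗ-identityˡ (⨂ᵗ (map u l)) ⟨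
      𝟙 ⊗ᵗ ⨂ᵗ (map u l)    ∼⟨ ⊗ᵗ-mono (𝟙⊑u j) ⊑-refl ⟩
      u j ⊗ᵗ ⨂ᵗ (map u l)  ≈⟨ ⨂ᵗ-cons (u j) (map u l) ⟨
      ⨂ᵗ (map u (j ∷ l))   ∎

  if-⊑ : ∀ b {x y w} → x ⊑ w → y ⊑ w → (if b then x else y) ⊑ w
  if-⊑ true  x⊑w _   = x⊑w
  if-⊑ false _   y⊑w = y⊑w

  ⨁ᵗ-least : ∀ {A : Set} (u : A → wAI m) l {w} → (∀ {i} → i ∈ l → u i ⊑ w) → ⨁ᵗ (map u l) ⊑ w
  ⨁ᵗ-least u []               _     = 𝟘-minimum _
  ⨁ᵗ-least u (i ∷ [])         bound = bound (here refl)
  ⨁ᵗ-least u (i ∷ l@(_ ∷ _)) bound =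
    ⊕ᵗ-least (bound (here refl)) (⨁ᵗ-least u l (λ i∈l → bound (there i∈l)))

  ⨂ᵗ-additive : ∀ x xs → Additive x → Additive (⨂ᵗ (x ∷ xs))
  ⨂ᵗ-additive x []       x-additive = x-additive
  ⨂ᵗ-additive x (y ∷ ys) _          = ⊗ᵗ-additive x (⨂ᵗ (y ∷ ys))

  x⊑y⇒x⊕ᵗy≡ᵂy : ∀ {x y} → x ⊑ y → Additive y → x ⊕ᵗ y ≡ᵂ y
  x⊑y⇒x⊕ᵗy≡ᵂy {x} {y} x⊑y y-additive γ = ≈-trans
    (∑-cong (members γ) (λ {a} _ → x≤y⇒x∨y≈y (⊑-at x⊑y a)))
    (≈-sym (y-additive γ))

  select : Bool → wAI m → wAI m
  select b x = if b then x else 𝟙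

  select⊑ : ∀ b {x} → 𝟙 ⊑ x → select b x ⊑ x
  select⊑ true  _   = ⊑-refl
  select⊑ false 𝟙⊑x = 𝟙⊑x

  𝟙⊑select : ∀ b {x} → 𝟙 ⊑ x → 𝟙 ⊑ select b x
  𝟙⊑select true  𝟙⊑x = 𝟙⊑x
  𝟙⊑select false _   = ⊑-refl

  ⊑select : ∀ {P : Set} (p : Dec P) x → P → x ⊑ select ⌊ p ⌋ x
  ⊑select (yes _) x _  = ⊑-refl
  ⊑select (no ¬p) x p = ⊥-elim (¬p p)

  select-⊗ᵗ : ∀ {P Q : Set} (p : Dec P) (q : Dec Q) x → ¬ (P × Q) →
    select ⌊ p ⌋ x ⊗ᵗ select ⌊ q ⌋ x ⊑ select ⌊ p ⊎-dec q ⌋ x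
  select-⊗ᵗ (yes p) (yes q) x ¬p×q = ⊥-elim (¬p×q (p , q))
  select-⊗ᵗ (yes _) (no _)  x _    = proj₁ (⊗ᵗ-identityʳ x)
  select-⊗ᵗ (no _)  (yes _) x _    = proj₁ (⊗ᵗ-identityˡ x)
  select-⊗ᵗ (no _)  (no _)  x _    = proj₁ (⊗ᵗ-identityˡ 𝟙)

  module _ {A : Set} {P : A → Set} (P? : Decidable P) (h : A → wAI m) where

    selected : A → wAI m
    selected j = select ⌊ P? j ⌋ (h j)

    ⨂ᵗ-filter⊑⨂ᵗ-selected : ∀ l → ⨂ᵗ (map h (filter P? l)) ⊑ ⨂ᵗ (map selected l)
    ⨂ᵗ-filter⊑⨂ᵗ-selected [] = ⊑-refl
    ⨂ᵗ-filter⊑⨂ᵗ-selected (j ∷ l) with P? j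
    ... | yes _ = begin
      ⨂ᵗ (h j ∷ map h (filter P? l))  ≈⟨ ⨂ᵗ-cons (h j) (map h (filter P? l)) ⟩
      h j ⊗ᵗ ⨂ᵗ (map h (filter P? l)) ∼⟨ ⊗ᵗ-monoˡ (h j) (⨂ᵗ-filter⊑⨂ᵗ-selected l) ⟩
      h j ⊗ᵗ ⨂ᵗ (map selected l)      ≈⟨ ⨂ᵗ-cons (h j) (map selected l) ⟨
      ⨂ᵗ (h j ∷ map selected l)       ∎
    ... | no _ = begin
      ⨂ᵗ (map h (filter P? l))        ≈⟨ ⊗ᵗ-identityˡ (⨂ᵗ (map h (filter P? l))) ⟨
      𝟙 ⊗ᵗ ⨂ᵗ (map h (filter P? l))   ∼⟨ ⊗ᵗ-monoˡ 𝟙 (⨂ᵗ-filter⊑⨂ᵗ-selected l) ⟩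
      𝟙 ⊗ᵗ ⨂ᵗ (map selected l)        ≈⟨ ⨂ᵗ-cons 𝟙 (map selected l) ⟨
      ⨂ᵗ (𝟙 ∷ map selected l)         ∎

  module FusionBound {N : ℕ} (xs : Vec (Bool × wAI m) N) where

    idx : List (Fin N)
    idx = toList (allFin N)

    α : Fin N → Bool
    α i = proj₁ (lookup xs i)

    z : Fin N → wAI m
    z i = proj₂ (lookup xs i)

    h : Fin N → wAI m
    h j = 𝟙 ⊕ᵗ z j

    𝟙⊑h : ∀ j → 𝟙 ⊑ h j
    𝟙⊑h j = x⊑x⊕ᵗy 𝟙 (z j)

    -- The decision procedures below are exactly the filters used by fusionSem.
    OtherTrigger : Fin N → Fin N → Set
    OtherTrigger i j = (⌊ ¬? (j ≟ᶠ i) ⌋ ∧ α j) ≡ true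

    otherTrigger? : ∀ i → Decidable (OtherTrigger i)
    otherTrigger? i j = ⌊ ¬? (j ≟ᶠ i) ⌋ ∧ α j BP.≟ true

    synchron? : Decidable (λ j → α j ≡ false)
    synchron? j = α j BP.≟ false

    trigger? : Decidable (λ j → α j ≡ true)
    trigger? j = α j BP.≟ true

    ¬otherTrigger-self : ∀ i → ¬ OtherTrigger i i
    ¬otherTrigger-self i t with i ≟ᶠ i
    ¬otherTrigger-self i () | yes _
    ... | no i≢i = i≢i refl

    ¬otherTrigger×synchron : ∀ i j → ¬ (OtherTrigger i j × α j ≡ false)
    ¬otherTrigger×synchron i j (t , s)
      with () ← ≡.trans (≡.sym t) (≡.trans (≡.cong (_ ∧_) s) (BP.∧-zeroʳ _))

    own otherTriggers : Fin N → Fin N → wAI m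
    own i           = selected (_≟ᶠ i) h
    otherTriggers i = selected (otherTrigger? i) h

    synchrons : Fin N → wAI m
    synchrons = selected synchron? h

    at-most-one-role : ∀ i → α i ≡ true → ∀ j → own i j ⊗ᵗ (otherTriggers i j ⊗ᵗ synchrons j) ⊑ h j
    at-most-one-role i αi j = begin
      own i j ⊗ᵗ (otherTriggers i j ⊗ᵗ synchrons j)
        ∼⟨ ⊗ᵗ-monoˡ (own i j)
             (select-⊗ᵗ (otherTrigger? i j) (synchron? j) (h j) (¬otherTrigger×synchron i j)) ⟩
      own i j ⊗ᵗ select ⌊ otherTrigger? i j ⊎-dec synchron? j ⌋ (h j)
        ∼⟨ select-⊗ᵗ (j ≟ᶠ i) (otherTrigger? i j ⊎-dec synchron? j) (h j) ¬own×other ⟩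
      select _ (h j)
        ∼⟨ select⊑ _ (𝟙⊑h j) ⟩
      h j ∎
      where
      ¬own×other : ¬ (j ≡ i × (OtherTrigger i j ⊎ α j ≡ false))
      ¬own×other (refl , inj₁ t) = ¬otherTrigger-self i t
      ¬own×other (refl , inj₂ s) with () ← ≡.trans (≡.sym αi) s

    summand : Fin N → wAI m
    summand i = z i ⊗ᵗ (⨂ᵗ (map h (filter (otherTrigger? i) idx)) ⊗ᵗ ⨂ᵗ (map h (filter synchron? idx)))

    summand⊑⨂ᵗh : ∀ i → α i ≡ true → summand i ⊑ ⨂ᵗ (map h idx)
    summand⊑⨂ᵗh i αi = begin
      summand i
        ∼⟨ ⊗ᵗ-mono (y⊑x⊕ᵗy 𝟙 (z i)) (⊗ᵗ-mono (⨂ᵗ-filter⊑⨂ᵗ-selected (otherTrigger? i) h idx)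
                                             (⨂ᵗ-filter⊑⨂ᵗ-selected synchron? h idx)) ⟩
      h i ⊗ᵗ (⨂ᵗ (map (otherTriggers i) idx) ⊗ᵗ ⨂ᵗ (map synchrons idx))
        ∼⟨ ⊗ᵗ-mono h-i⊑ (⨂ᵗ-⊗ᵗ-interchange (otherTriggers i) synchrons idx) ⟩
      ⨂ᵗ (map (own i) idx) ⊗ᵗ ⨂ᵗ (map (λ j → otherTriggers i j ⊗ᵗ synchrons j) idx)
        ∼⟨ ⨂ᵗ-⊗ᵗ-interchange (own i) _ idx ⟩
      ⨂ᵗ (map (λ j → own i j ⊗ᵗ (otherTriggers i j ⊗ᵗ synchrons j)) idx)
        ∼⟨ ⨂ᵗ-mono idx (at-most-one-role i αi) ⟩
      ⨂ᵗ (map h idx) ∎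
      where
      h-i⊑ : h i ⊑ ⨂ᵗ (map (own i) idx)
      h-i⊑ = ⊑-trans (⊑select (i ≟ᶠ i) (h i) refl)
                     (factor⊑⨂ᵗ (λ j → 𝟙⊑select _ (𝟙⊑h j)) (∈-toList⁺ (∈-allFin⁺ i)))

    fusionSem⊑⨂ᵗh : fusionSem xs ⊑ ⨂ᵗ (map h idx)
    fusionSem⊑⨂ᵗh = if-⊑ (any α idx)
      (⨁ᵗ-least summand (filter trigger? idx)
        (λ i∈ → summand⊑⨂ᵗh _ (proj₂ (∈-filter⁻ trigger? {xs = idx} i∈))))
      (⨂ᵗ-mono idx (λ j → y⊑x⊕ᵗy 𝟙 (z j)))

map-lookup-allFin : ∀ {A B : Set} {N} (g : A → B) (v : Vec A N) →
  map (λ j → g (lookup v j)) (toList (allFin N)) ≡ toList (V.map g v)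
map-lookup-allFin {N = N} g v = begin
  map (g ∘ lookup v) (toList (allFin N))
    ≡⟨ VP.toList-map (g ∘ lookup v) (allFin N) ⟨
  toList (V.map (g ∘ lookup v) (allFin N))
    ≡⟨ ≡.cong toList (VP.map-∘ g (lookup v) (allFin N)) ⟩
  toList (V.map g (V.map (lookup v) (allFin N)))
    ≡⟨ ≡.cong (toList ∘ V.map g) (VP.map-lookup-allFin v) ⟩
  toList (V.map g v) ∎
  where open ≡.≡-Reasoning

map-semVec-zipWith : ∀ {m N} {B : Set} (g : wAI m → B) (ζ : Vec (wAC m) N) (α : Vec Bool N) →
  V.map (g ∘ proj₂) (semVec (zipWith [_]^_ ζ α)) ≡ V.map (g ∘ ∣_∣) ζ
map-semVec-zipWith g []       []       = refl
map-semVec-zipWith g (ζ ∷ ζs) (α ∷ αs) = ≡.cong (g ∣ ζ ∣ ∷_) (map-semVec-zipWith g ζs αs)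

proposition5 : {c ℓ : Level} (K : CommutativeSemiring c ℓ)
    → Idempotent (CommutativeSemiring._≈_ K) (CommutativeSemiring._+_ K)
    → (m : ℕ) (k : Fin (suc m) → CommutativeSemiring.Carrier K)
    → (n : ℕ) (ζ : Vec (wAC (suc m)) (suc n)) (α : Vec Bool (suc n))
    → Sem._≡ᵂ_ K k
        (∣ fuse (zipWith [_]^_ ζ α) ∣ ⊕ᵗ ⨂ᵗ (toList (V.map (λ ζᵢ → 𝟙 ⊕ᵗ ∣ ζᵢ ∣) ζ)))
        (⨂ᵗ (toList (V.map (λ ζᵢ → 𝟙 ⊕ᵗ ∣ ζᵢ ∣) ζ)))
proposition5 K +-idem m k n ζ@(ζ₀ ∷ ζs) α =
  x⊑y⇒x⊕ᵗy≡ᵂy fusion⊑factors (⨂ᵗ-additive (h ζ₀) (toList (V.map h ζs)) (⊕ᵗ-additive 𝟙 ∣ ζ₀ ∣))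
  where
  open Singletonwise K +-idem k

  h : wAC (suc m) → wAI (suc m)
  h ζᵢ = 𝟙 ⊕ᵗ ∣ ζᵢ ∣

  xs : Vec (Bool × wAI (suc m)) (suc n)
  xs = semVec (zipWith [_]^_ ζ α)

  fusion⊑factors : fusionSem xs ⊑ ⨂ᵗ (toList (V.map h ζ))
  fusion⊑factors = ≡.subst (λ factors → fusionSem xs ⊑ ⨂ᵗ factors)
    (≡.trans (map-lookup-allFin (λ p → 𝟙 ⊕ᵗ proj₂ p) xs)
             (≡.cong toList (map-semVec-zipWith (𝟙 ⊕ᵗ_) ζ α)))
    (FusionBound.fusionSem⊑⨂ᵗh xs)
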